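{- Let $X$, $Y$ be finite nonempty sets and let $F: X\to 2^Y$ be an alldifferent set-valued mapping. Then $F(W)\cap F(X\setminus W)=\emptyset$ for each critical set $W\subset X$ of $F$.
   Context: A set-valued mapping $F: X \to 2^Y$ assigns to each $x$ a (possibly empty) subset $F(x) \subset Y$; $F(W) = \bigcup_{x\in W}F(x)$; $\sharp$ is cardinality. A selection of $F$ is $s: X\to Y$ with $s(x)\in F(x)$ for all $x$; alldifferent means injective. The alldifferent kernel is $F^*(x) = \{y\in F(x): \exists$ alldifferent selection $s$ of $F$ with $s(x)=y\}$; $F$ is alldifferent if $F(x)\ne\emptyset$ for all $x$ and $F^*=F$. $W\subset X$ is a critical set of $F$ if $W\ne\emptyset$ and $\sharp F(W)=\sharp W$. -}

module Defs where

open import Data.Nat using (ℕ)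
open import Data.Fin using (Fin)
open import Data.Fin.Subset using (Subset; _∈_; ⋃; ⊥; ∣_∣; Nonempty)
open import Data.Bool using (if_then_else_)
open import Data.Vec using (lookup)
open import Data.List using (map; allFin)
open import Data.Product using (Σ; _×_)
open import Function.Definitions using (Injective)
open import Relation.Binary.PropositionalEquality using (_≡_)

SetMap : ℕ → ℕ → Set
SetMap m n = Fin m → Subset n

image : ∀ {m n} → SetMap m n → Subset m → Subset n
image {m} F W = ⋃ (map (λ x → if lookup W x then F x else ⊥) (allFin m))

IsSelection : ∀ {m n} → SetMap m n → (Fin m → Fin n) → Set
IsSelection F s = ∀ x → s x ∈ F x

IsAlldiffSelection : ∀ {m n} → SetMap m n → (Fin m → Fin n) → Set
IsAlldiffSelection F s = IsSelection F s × Injective _≡_ _≡_ s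

_∈Kernel_at_ : ∀ {m n} → Fin n → SetMap m n → Fin m → Set
y ∈Kernel F at x = y ∈ F x × Σ _ (λ s → IsAlldiffSelection F s × s x ≡ y)

IsAlldifferent : ∀ {m n} → SetMap m n → Set
IsAlldifferent F = (∀ x → Nonempty (F x)) × (∀ x y → y ∈ F x → y ∈Kernel F at x)

IsCritical : ∀ {m n} → SetMap m n → Subset m → Set
IsCritical F W = Nonempty W × ∣ image F W ∣ ≡ ∣ W ∣

-- If y ∈ F(W) ∩ F(X ∖ W), say y ∈ F(x) with x ∉ W, then since F is alldifferent
-- some injective selection s has s(x) = y. Injectivity keeps s(W) away from y, so s
-- maps W injectively into F(W) ∖ {y}, whence ♯W < ♯F(W), contradicting criticality.
module Submission where

open import Defs
open import Data.Nat using (ℕ; suc; _≤_; _<_; s≤s; z≤n)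
open import Data.Nat.Properties using (≤-trans; ≤-<-trans; <-irrefl)
open import Data.Fin using (Fin; zero; suc)
open import Data.Fin.Properties using (0≢1+n; suc-injective)
open import Data.Fin.Subset
  using (Subset; _∈_; _∉_; _∩_; ∁; ⊥; ⋃; ∣_∣; _-_; inside; outside; Nonempty)
open import Data.Fin.Subset.Properties
  using (∉⊥; x∈p∪q⁺; x∈p∪q⁻; x∈p∩q⁻; x∈∁p⇒x∉p; Empty-unique; x∈p∧x≢y⇒x∈p-y; x∈p⇒∣p-x∣<∣p∣)
open import Data.Vec using ([]; _∷_; here; there; lookup)
open import Data.Vec.Properties using (lookup⇒[]=; []=⇒lookup)
open import Data.Bool using (true; false; if_then_else_)
open import Data.List using (List; []; _∷_; map; allFin)
open import Data.List.Relation.Unary.Any using (Any; here; there; satisfied)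
open import Data.List.Relation.Unary.Any.Properties using (map⁺; map⁻)
open import Data.List.Membership.Propositional using (lose)
open import Data.List.Membership.Propositional.Properties using (∈-allFin)
open import Data.Product using (∃; _×_; _,_)
open import Data.Sum using ([_,_]; inj₁; inj₂)
open import Data.Empty using (⊥-elim)
open import Function using (_∘_)
open import Function.Definitions using (Injective)
open import Relation.Nullary using (¬_)
open import Relation.Binary.PropositionalEquality using (_≡_; refl; sym; subst)

private
  variable
    m n : ℕ

x∈⋃⁺ : ∀ {ps : List (Subset n)} {x} → Any (x ∈_) ps → x ∈ ⋃ ps
x∈⋃⁺ (here x∈p)   = x∈p∪q⁺ (inj₁ x∈p)
x∈⋃⁺ (there x∈ps) = x∈p∪q⁺ (inj₂ (x∈⋃⁺ x∈ps))

x∈⋃⁻ : ∀ (ps : List (Subset n)) {x} → x ∈ ⋃ ps → Any (x ∈_) ps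
x∈⋃⁻ []       x∈⊥   = ⊥-elim (∉⊥ x∈⊥)
x∈⋃⁻ (p ∷ ps) x∈p∪q = [ here , there ∘ x∈⋃⁻ ps ] (x∈p∪q⁻ p (⋃ ps) x∈p∪q)

∈-if⁻ : ∀ b {p : Subset n} {y} → y ∈ (if b then p else ⊥) → b ≡ true × y ∈ p
∈-if⁻ true  y∈p = refl , y∈p
∈-if⁻ false y∈⊥ = ⊥-elim (∉⊥ y∈⊥)

module _ (F : SetMap m n) {W : Subset m} where

  private
    F↾W : Fin m → Subset n
    F↾W x = if lookup W x then F x else ⊥

  ∈-image⁺ : ∀ {x y} → x ∈ W → y ∈ F x → y ∈ image F W
  ∈-image⁺ {x} {y} x∈W y∈Fx = x∈⋃⁺ (map⁺ (lose (∈-allFin x) y∈Fx-if))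
    where
    y∈Fx-if : y ∈ F↾W x
    y∈Fx-if rewrite []=⇒lookup x∈W = y∈Fx

  ∈-image⁻ : ∀ {y} → y ∈ image F W → ∃ λ x → x ∈ W × y ∈ F x
  ∈-image⁻ y∈FW with satisfied (map⁻ (x∈⋃⁻ (map F↾W (allFin m)) y∈FW))
  ... | x , y∈Fx-if with ∈-if⁻ (lookup W x) y∈Fx-if
  ...   | x∈W , y∈Fx = x , lookup⇒[]= x W x∈W , y∈Fx

injection⇒∣p∣≤∣q∣ : ∀ (p : Subset m) {q : Subset n} {s : Fin m → Fin n} →
                    Injective _≡_ _≡_ s → (∀ {x} → x ∈ p → s x ∈ q) → ∣ p ∣ ≤ ∣ q ∣
injection⇒∣p∣≤∣q∣ []            _   _   = z≤n
injection⇒∣p∣≤∣q∣ (outside ∷ p) inj s∈q =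
  injection⇒∣p∣≤∣q∣ p (λ e → suc-injective (inj e)) (s∈q ∘ there)
injection⇒∣p∣≤∣q∣ (inside ∷ p) {q} {s} inj s∈q =
  ≤-trans (s≤s (injection⇒∣p∣≤∣q∣ p (λ e → suc-injective (inj e)) s∈q-s₀))
          (x∈p⇒∣p-x∣<∣p∣ (s∈q here))
  where
  s∈q-s₀ : ∀ {x} → x ∈ p → s (suc x) ∈ q - s zero
  s∈q-s₀ x∈p = x∈p∧x≢y⇒x∈p-y (s∈q (there x∈p)) (λ e → 0≢1+n (inj (sym e)))

selection-hits-image⇒∣W∣<∣image∣ :
  ∀ {F : SetMap m n} {s} → IsAlldiffSelection F s →
  ∀ (W : Subset m) {x} → x ∉ W → s x ∈ image F W → ∣ W ∣ < ∣ image F W ∣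
selection-hits-image⇒∣W∣<∣image∣ {F = F} {s} (sel , inj) W {x} x∉W sx∈FW =
  ≤-<-trans (injection⇒∣p∣≤∣q∣ W inj s∈FW-sx) (x∈p⇒∣p-x∣<∣p∣ sx∈FW)
  where
  s∈FW-sx : ∀ {w} → w ∈ W → s w ∈ image F W - s x
  s∈FW-sx {w} w∈W = x∈p∧x≢y⇒x∈p-y (∈-image⁺ F w∈W (sel w))
                      (λ e → x∉W (subst (_∈ W) (inj e) w∈W))

lemma5p3 : (m n : ℕ) (F : SetMap (suc m) (suc n)) → IsAlldifferent F →
           (W : Subset (suc m)) → IsCritical F W →
           image F W ∩ image F (∁ W) ≡ ⊥
lemma5p3 m n F (_ , F*≡F) W (_ , ∣FW∣≡∣W∣) = Empty-unique disjoint
  where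
  disjoint : ¬ Nonempty (image F W ∩ image F (∁ W))
  disjoint (y , y∈FW∩FW̅) with x∈p∩q⁻ (image F W) _ y∈FW∩FW̅
  ... | y∈FW , y∈FW̅ with ∈-image⁻ F y∈FW̅
  ... | x , x∈W̅ , y∈Fx with F*≡F x y y∈Fx
  ... | _ , s , alldiff , sx≡y =
    <-irrefl (sym ∣FW∣≡∣W∣)
      (selection-hits-image⇒∣W∣<∣image∣ alldiff W (x∈∁p⇒x∉p x∈W̅)
        (subst (_∈ image F W) (sym sx≡y) y∈FW))
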